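{- For every positive integer $s$, the group $\mathbb{Z}_2^{2s-2}\times\mathbb{Z}_4$ has a perfect restricted $s$-basis of size $2s+1$.
   Context: A subset $A$ of a finite abelian group $G$ is a perfect restricted $s$-basis of $G$ if every element of $G$ can be written as a sum of at most $s$ pairwise distinct elements of $A$ (the empty sum giving $0$), and this representation is unique apart from the order of the terms; equivalently, the sums $\sum_{a\in S}a$ over subsets $S\subseteq A$ with $|S|\le s$ are pairwise distinct and cover $G$. $\mathbb{Z}_n=\mathbb{Z}/n\mathbb{Z}$; for $s=1$ the group is $\mathbb{Z}_4$. -}

module Defs where

open import Data.Nat using (ℕ; zero; suc; NonZero)
import Data.Nat as ℕ
open import Data.Nat.DivMod using (_mod_)
open import Data.Fin using (Fin; toℕ)
open import Data.Fin.Subset using (Subset; ∣_∣; inside; outside)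
open import Data.Vec using (Vec; []; _∷_; zipWith; replicate)
open import Data.Product using (_×_; _,_; ∃)
open import Relation.Binary.PropositionalEquality using (_≡_)

_+ₙ_ : {n : ℕ} .{{_ : NonZero n}} → Fin n → Fin n → Fin n
_+ₙ_ {n} a b = (toℕ a ℕ.+ toℕ b) mod n

0ₙ : {n : ℕ} .{{_ : NonZero n}} → Fin n
0ₙ {n} = 0 mod n

G : ℕ → Set
G m = Vec (Fin 2) m × Fin 4

_⊕_ : {m : ℕ} → G m → G m → G m
(u , a) ⊕ (v , b) = zipWith _+ₙ_ u v , (a +ₙ b)

𝟘 : {m : ℕ} → G m
𝟘 {m} = replicate m 0ₙ , 0ₙ

subsetSum : {m k : ℕ} → Vec (G m) k → Subset k → G m
subsetSum [] [] = 𝟘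
subsetSum (a ∷ as) (inside ∷ S) = a ⊕ subsetSum as S
subsetSum (a ∷ as) (outside ∷ S) = subsetSum as S

-- A (given as a list of k pairwise distinct elements, see the statement)
-- is a perfect restricted s-basis: the sums over sub-collections of at
-- most s elements are pairwise distinct and cover the group.
PerfectRestrictedBasis : {m k : ℕ} → ℕ → Vec (G m) k → Set
PerfectRestrictedBasis {m} {k} s A =
  ((g : G m) → ∃ λ (S : Subset k) → (∣ S ∣ ℕ.≤ s) × (subsetSum A S ≡ g))
  × ((S T : Subset k) → ∣ S ∣ ℕ.≤ s → ∣ T ∣ ℕ.≤ s →
       subsetSum A S ≡ subsetSum A T → S ≡ T)

-- The basis is (0, 1), (0, 2), (𝟙, 3) and the (eᵢ, 1) for the m = 2s - 2 unit vectors eᵢ.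
-- A subset consists of a digit d ∈ ℤ₄ taken from the first two elements, costing the
-- binary weight of d, a flag t for (𝟙, 3), and a set T of unit vectors. Its ℤ₂ᵐ-part is
-- T or the complement of T according to t, so for a target (v, c) the flag determines T,
-- and the two branches have loads |T| + t adding up to 2s - 1. If one load is at most
-- s - 2, only that branch fits and every digit is affordable. Otherwise the loads are
-- s - 1 and s: the first branch reaches its offset plus {0, 1, 2}, the second only its
-- own offset, which is three more. Either way every c ∈ ℤ₄ is hit exactly once.
module Submission where

open import Defs
open import Data.Bool using (Bool; true; false; not)
open import Data.Nat using (ℕ; zero; suc; _+_; _*_; _∸_; _≤_; _≤?_; z≤n; s≤s)
open import Data.Nat.Properties hiding (_≟_)
open import Data.Fin using (Fin; zero; suc; _≟_)
open import Data.Fin.Properties using (all?; any?)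
open import Data.Fin.Subset using (Subset; ∣_∣; _∈_; inside; outside; ⁅_⁆) renaming (⊥ to ∅)
open import Data.Fin.Subset.Properties using (∣⁅x⁆∣≡1; x∈⁅x⁆; x∈⁅y⁆⇒x≡y)
open import Data.Vec using (Vec; []; _∷_; _++_; lookup; replicate; zipWith; map)
open import Data.Product using (_×_; ∃; ∃₂; _,_; proj₁; proj₂)
open import Data.Sum using (_⊎_; inj₁; inj₂)
open import Data.Empty using (⊥-elim)
open import Function.Definitions using (Injective)
open import Relation.Nullary using (yes; no)
open import Relation.Nullary.Decidable using (from-yes; _→-dec_)
open import Relation.Binary.PropositionalEquality

ℤ₄ : Set
ℤ₄ = Fin 4

pattern 1₄ = suc zero
pattern 2₄ = suc (suc zero)
pattern 3₄ = suc (suc (suc zero))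

+₄-identityˡ : ∀ (c : ℤ₄) → zero +ₙ c ≡ c
+₄-identityˡ = from-yes (all? λ (c : ℤ₄) → zero +ₙ c ≟ c)

+₄-identityʳ : ∀ (c : ℤ₄) → c +ₙ zero ≡ c
+₄-identityʳ = from-yes (all? λ (c : ℤ₄) → c +ₙ zero ≟ c)

+₄-assoc : ∀ (a b c : ℤ₄) → a +ₙ (b +ₙ c) ≡ (a +ₙ b) +ₙ c
+₄-assoc = from-yes (all? λ (a : ℤ₄) → all? λ (b : ℤ₄) → all? λ (c : ℤ₄) →
  a +ₙ (b +ₙ c) ≟ (a +ₙ b) +ₙ c)

+₄-cancelʳ : ∀ (a b c : ℤ₄) → a +ₙ c ≡ b +ₙ c → a ≡ b
+₄-cancelʳ = from-yes (all? λ (a : ℤ₄) → all? λ (b : ℤ₄) → all? λ (c : ℤ₄) →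
  (a +ₙ c ≟ b +ₙ c) →-dec (a ≟ b))

+₄-solvable : ∀ (c e : ℤ₄) → ∃ λ d → d +ₙ e ≡ c
+₄-solvable = from-yes (all? λ (c : ℤ₄) → all? λ (e : ℤ₄) → any? λ d → d +ₙ e ≟ c)

toℤ₄ : ℕ → ℤ₄
toℤ₄ zero = zero
toℤ₄ (suc n) = 1₄ +ₙ toℤ₄ n

-- d = x · 1 + y · 2, realised by the basis elements (0, 1) and (0, 2).
digits : ℤ₄ → Subset 2
digits zero = outside ∷ outside ∷ []
digits 1₄ = inside ∷ outside ∷ []
digits 2₄ = outside ∷ inside ∷ []
digits 3₄ = inside ∷ inside ∷ []

digits-surjective : ∀ x y → ∃ λ d → digits d ≡ x ∷ y ∷ []
digits-surjective outside outside = zero , refl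
digits-surjective inside outside = 1₄ , refl
digits-surjective outside inside = 2₄ , refl
digits-surjective inside inside = 3₄ , refl

cost : ℤ₄ → ℕ
cost d = ∣ digits d ∣

cost≤2 : ∀ d → cost d ≤ 2
cost≤2 zero = z≤n
cost≤2 1₄ = s≤s z≤n
cost≤2 2₄ = s≤s z≤n
cost≤2 3₄ = ≤-refl

d≢3⇒cost≤1 : ∀ {d} → d ≢ 3₄ → cost d ≤ 1
d≢3⇒cost≤1 {zero} _ = z≤n
d≢3⇒cost≤1 {1₄} _ = ≤-refl
d≢3⇒cost≤1 {2₄} _ = ≤-refl
d≢3⇒cost≤1 {3₄} d≢3 = ⊥-elim (d≢3 refl)

cost≡0⇒d≡0 : ∀ {d} → cost d ≡ 0 → d ≡ zero
cost≡0⇒d≡0 {zero} _ = refl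
cost≡0⇒d≡0 {1₄} ()
cost≡0⇒d≡0 {2₄} ()
cost≡0⇒d≡0 {3₄} ()

-- Along branch t, the digit d costs cost d + k t basis elements and reaches d + e t;
-- s = suc p is the allowed number of elements.
module TwoBranches (p : ℕ) (k : Bool → ℕ) (e : Bool → ℤ₄)
  (load-sum : k false + k true ≡ suc (p + p))
  (boundary : ∀ t → k t ≡ p → e (not t) ≡ 3₄ +ₙ e t) where

  Fits : Bool → ℤ₄ → Set
  Fits t d = cost d + k t ≤ suc p

  load-sum′ : ∀ t → k t + k (not t) ≡ suc (p + p)
  load-sum′ false = load-sum
  load-sum′ true = trans (+-comm (k true) (k false)) load-sum

  other-load : ∀ t → k t ≡ p → k (not t) ≡ suc p
  other-load t kt≡p = +-cancelˡ-≡ p _ _ (begin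
    p + k (not t)       ≡⟨ cong (_+ k (not t)) (sym kt≡p) ⟩
    k t + k (not t)     ≡⟨ load-sum′ t ⟩
    suc (p + p)         ≡⟨ sym (+-suc p p) ⟩
    p + suc p           ∎)
    where open ≡-Reasoning

  cover-from : ∀ t → k t ≤ p → ∀ c → ∃₂ λ t′ d → Fits t′ d × d +ₙ e t′ ≡ c
  cover-from t kt≤p c with +₄-solvable c (e t) | m≤n⇒m<n∨m≡n kt≤p
  ... | d , d+e≡c | inj₁ kt<p = t , d , ≤-trans (+-monoˡ-≤ (k t) (cost≤2 d)) (s≤s kt<p) , d+e≡c
  ... | d , d+e≡c | inj₂ kt≡p with d ≟ 3₄
  ...   | no d≢3 = t , d , +-mono-≤ (d≢3⇒cost≤1 d≢3) (≤-reflexive kt≡p) , d+e≡c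
  ...   | yes refl = not t , zero , ≤-reflexive (other-load t kt≡p) ,
                     trans (+₄-identityˡ (e (not t))) (trans (boundary t kt≡p) d+e≡c)

  cover : ∀ c → ∃₂ λ t d → Fits t d × d +ₙ e t ≡ c
  cover with k false ≤? p
  ... | yes kf≤p = cover-from false kf≤p
  ... | no kf≰p = cover-from true (+-cancelˡ-≤ (suc p) (k true) p (begin
    suc p + k true      ≤⟨ +-monoˡ-≤ (k true) (≰⇒> kf≰p) ⟩
    k false + k true    ≡⟨ load-sum ⟩
    suc p + p           ∎))
    where open ≤-Reasoning

  fits⇒load≤ : ∀ t d → Fits t d → k t ≤ suc p
  fits⇒load≤ t d = ≤-trans (m≤n+m (k t) (cost d))

  some-load≡p : ∀ {a b} → a ≤ suc p → b ≤ suc p → a + b ≡ suc (p + p) → a ≡ p ⊎ b ≡ p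
  some-load≡p {a} {b} a≤ b≤ a+b≡ with a ≤? p
  ... | yes a≤p = inj₁ (≤-antisym a≤p (+-cancelʳ-≤ p p a (≤-pred (begin
    suc (p + p)         ≡⟨ sym a+b≡ ⟩
    a + b               ≤⟨ +-monoʳ-≤ a b≤ ⟩
    a + suc p           ≡⟨ +-suc a p ⟩
    suc (a + p)         ∎))))
    where open ≤-Reasoning
  ... | no a≰p = inj₂ (+-cancelˡ-≡ (suc p) b p
    (trans (cong (_+ b) (sym (≤-antisym a≤ (≰⇒> a≰p)))) a+b≡))

  -- At the boundary branch t can only reach e t + {0, 1, 2}, and branch (not t)
  -- only e (not t) = e t + 3.
  boundary-disjoint : ∀ t d d′ → k t ≡ p → Fits t d → Fits (not t) d′ →
                      d +ₙ e t ≢ d′ +ₙ e (not t)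
  boundary-disjoint t d d′ kt≡p fits fits′ eq =
    n≮n (suc p) (subst₂ (λ d n → cost d + n ≤ suc p) d≡3 kt≡p fits)
    where
    d′≡0 : d′ ≡ zero
    d′≡0 = cost≡0⇒d≡0 (n≤0⇒n≡0 (+-cancelʳ-≤ (suc p) (cost d′) 0
             (subst (λ n → cost d′ + n ≤ suc p) (other-load t kt≡p) fits′)))
    d≡3 : d ≡ 3₄
    d≡3 = +₄-cancelʳ d 3₄ (e t) (begin
      d +ₙ e t           ≡⟨ eq ⟩
      d′ +ₙ e (not t)    ≡⟨ cong (_+ₙ e (not t)) d′≡0 ⟩
      zero +ₙ e (not t)  ≡⟨ +₄-identityˡ (e (not t)) ⟩
      e (not t)          ≡⟨ boundary t kt≡p ⟩
      3₄ +ₙ e t          ∎)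
      where open ≡-Reasoning

  unique : ∀ t t′ d d′ → Fits t d → Fits t′ d′ → d +ₙ e t ≡ d′ +ₙ e t′ → t ≡ t′ × d ≡ d′
  unique false false d d′ _ _ eq = refl , +₄-cancelʳ d d′ (e false) eq
  unique true true d d′ _ _ eq = refl , +₄-cancelʳ d d′ (e true) eq
  unique false true d d′ fits fits′ eq
    with some-load≡p (fits⇒load≤ false d fits) (fits⇒load≤ true d′ fits′) load-sum
  ... | inj₁ kf≡p = ⊥-elim (boundary-disjoint false d d′ kf≡p fits fits′ eq)
  ... | inj₂ kt≡p = ⊥-elim (boundary-disjoint true d′ d kt≡p fits′ fits (sym eq))
  unique true false d d′ fits fits′ eq with unique false true d′ d fits′ fits (sym eq)
  ... | () , _

flip : ∀ {n} → Vec (Fin 2) n → Vec (Fin 2) n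
flip {n} u = zipWith _+ₙ_ (replicate n (suc zero)) u

flip-involutive : ∀ {n} (u : Vec (Fin 2) n) → flip (flip u) ≡ u
flip-involutive [] = refl
flip-involutive (zero ∷ u) = cong (zero ∷_) (flip-involutive u)
flip-involutive (suc zero ∷ u) = cong (suc zero ∷_) (flip-involutive u)

flipIf : ∀ {n} → Bool → Vec (Fin 2) n → Vec (Fin 2) n
flipIf true u = flip u
flipIf false u = u

flipIf-involutive : ∀ {n} t (u : Vec (Fin 2) n) → flipIf t (flipIf t u) ≡ u
flipIf-involutive true u = flip-involutive u
flipIf-involutive false u = refl

+ᵛ-identityˡ : ∀ {n} (u : Vec (Fin 2) n) → zipWith _+ₙ_ (replicate n zero) u ≡ u
+ᵛ-identityˡ [] = refl
+ᵛ-identityˡ (zero ∷ u) = cong (zero ∷_) (+ᵛ-identityˡ u)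
+ᵛ-identityˡ (suc zero ∷ u) = cong (suc zero ∷_) (+ᵛ-identityˡ u)

+ᵛ-identityʳ : ∀ {n} (u : Vec (Fin 2) n) → zipWith _+ₙ_ u (replicate n zero) ≡ u
+ᵛ-identityʳ [] = refl
+ᵛ-identityʳ (zero ∷ u) = cong (zero ∷_) (+ᵛ-identityʳ u)
+ᵛ-identityʳ (suc zero ∷ u) = cong (suc zero ∷_) (+ᵛ-identityʳ u)

⊕-identityʳ : ∀ {m} (g : G m) → g ⊕ 𝟘 ≡ g
⊕-identityʳ (u , c) = cong₂ _,_ (+ᵛ-identityʳ u) (+₄-identityʳ c)

bits : ∀ {n} → Subset n → Vec (Fin 2) n
bits [] = []
bits (inside ∷ T) = suc zero ∷ bits T
bits (outside ∷ T) = zero ∷ bits T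

toSubset : ∀ {n} → Vec (Fin 2) n → Subset n
toSubset [] = []
toSubset (zero ∷ u) = outside ∷ toSubset u
toSubset (suc zero ∷ u) = inside ∷ toSubset u

bits-toSubset : ∀ {n} (u : Vec (Fin 2) n) → bits (toSubset u) ≡ u
bits-toSubset [] = refl
bits-toSubset (zero ∷ u) = cong (zero ∷_) (bits-toSubset u)
bits-toSubset (suc zero ∷ u) = cong (suc zero ∷_) (bits-toSubset u)

toSubset-bits : ∀ {n} (T : Subset n) → toSubset (bits T) ≡ T
toSubset-bits [] = refl
toSubset-bits (inside ∷ T) = cong (inside ∷_) (toSubset-bits T)
toSubset-bits (outside ∷ T) = cong (outside ∷_) (toSubset-bits T)

∣toSubset∣+∣toSubset∘flip∣≡n : ∀ {n} (u : Vec (Fin 2) n) → ∣ toSubset u ∣ + ∣ toSubset (flip u) ∣ ≡ n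
∣toSubset∣+∣toSubset∘flip∣≡n [] = refl
∣toSubset∣+∣toSubset∘flip∣≡n (zero ∷ u) =
  trans (+-suc _ _) (cong suc (∣toSubset∣+∣toSubset∘flip∣≡n u))
∣toSubset∣+∣toSubset∘flip∣≡n (suc zero ∷ u) = cong suc (∣toSubset∣+∣toSubset∘flip∣≡n u)

subsetSum-∅ : ∀ {m k} (X : Vec (G m) k) → subsetSum X ∅ ≡ 𝟘
subsetSum-∅ [] = refl
subsetSum-∅ (x ∷ X) = subsetSum-∅ X

subsetSum-⁅⁆ : ∀ {m k} (X : Vec (G m) k) i → subsetSum X ⁅ i ⁆ ≡ lookup X i
subsetSum-⁅⁆ (x ∷ X) zero = trans (cong (x ⊕_) (subsetSum-∅ X)) (⊕-identityʳ x)
subsetSum-⁅⁆ (x ∷ X) (suc i) = subsetSum-⁅⁆ X i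

perfect⇒injective : ∀ {m k s} (A : Vec (G m) k) → 1 ≤ s → PerfectRestrictedBasis s A →
                    Injective _≡_ _≡_ (lookup A)
perfect⇒injective {s = s} A 1≤s (_ , unique) {i} {j} Aᵢ≡Aⱼ =
  x∈⁅y⁆⇒x≡y j (subst (i ∈_) ⁅i⁆≡⁅j⁆ (x∈⁅x⁆ i))
  where
  singleton-fits : ∀ i → ∣ ⁅ i ⁆ ∣ ≤ s
  singleton-fits i = subst (_≤ s) (sym (∣⁅x⁆∣≡1 i)) 1≤s
  ⁅i⁆≡⁅j⁆ : ⁅ i ⁆ ≡ ⁅ j ⁆
  ⁅i⁆≡⁅j⁆ = unique ⁅ i ⁆ ⁅ j ⁆ (singleton-fits i) (singleton-fits j)
    (trans (subsetSum-⁅⁆ A i) (trans Aᵢ≡Aⱼ (sym (subsetSum-⁅⁆ A j))))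

lift : ∀ {m} → G m → G (suc m)
lift (u , c) = zero ∷ u , c

subsetSum-map-lift : ∀ {m k} (X : Vec (G m) k) (T : Subset k) →
                     subsetSum (map lift X) T ≡ lift (subsetSum X T)
subsetSum-map-lift [] [] = refl
subsetSum-map-lift (x ∷ X) (inside ∷ T) = cong (lift x ⊕_) (subsetSum-map-lift X T)
subsetSum-map-lift (x ∷ X) (outside ∷ T) = subsetSum-map-lift X T

unitVectors : ∀ m → Vec (G m) m
unitVectors zero = []
unitVectors (suc m) = (suc zero ∷ replicate m zero , 1₄) ∷ map lift (unitVectors m)

subsetSum-unitVectors : ∀ {m} (T : Subset m) → subsetSum (unitVectors m) T ≡ (bits T , toℤ₄ ∣ T ∣)
subsetSum-unitVectors [] = refl
subsetSum-unitVectors {suc m} (inside ∷ T)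
  rewrite subsetSum-map-lift (unitVectors m) T | subsetSum-unitVectors T | +ᵛ-identityˡ (bits T) = refl
subsetSum-unitVectors {suc m} (outside ∷ T)
  rewrite subsetSum-map-lift (unitVectors m) T | subsetSum-unitVectors T = refl

basis : ∀ m → Vec (G m) (3 + m)
basis m = (replicate m zero , 1₄) ∷ (replicate m zero , 2₄) ∷ (replicate m (suc zero) , 3₄) ∷ unitVectors m

subsetSum-digits : ∀ {m k} (d : ℤ₄) (X : Vec (G m) k) (S : Subset k) →
  subsetSum ((replicate m zero , 1₄) ∷ (replicate m zero , 2₄) ∷ X) (digits d ++ S)
    ≡ (proj₁ (subsetSum X S) , d +ₙ proj₂ (subsetSum X S))
subsetSum-digits zero X S = cong (proj₁ (subsetSum X S) ,_) (sym (+₄-identityˡ _))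
subsetSum-digits 1₄ X S = cong (_, 1₄ +ₙ proj₂ (subsetSum X S)) (+ᵛ-identityˡ _)
subsetSum-digits 2₄ X S = cong (_, 2₄ +ₙ proj₂ (subsetSum X S)) (+ᵛ-identityˡ _)
subsetSum-digits 3₄ X S =
  cong₂ _,_ (trans (+ᵛ-identityˡ _) (+ᵛ-identityˡ _)) (+₄-assoc 1₄ 2₄ (proj₂ (subsetSum X S)))

part : ∀ {m} → Bool → Vec (Fin 2) m → Subset m
part t v = toSubset (flipIf t v)

config : ∀ {m} → Vec (Fin 2) m → Bool → ℤ₄ → Subset (3 + m)
config v t d = digits d ++ t ∷ part t v

load : ∀ {m} → Vec (Fin 2) m → Bool → ℕ
load v t = ∣ t ∷ part t v ∣

offset : ∀ {m} → Vec (Fin 2) m → Bool → ℤ₄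
offset v false = toℤ₄ ∣ part false v ∣
offset v true = 3₄ +ₙ toℤ₄ ∣ part true v ∣

config-size : ∀ {m} (v : Vec (Fin 2) m) t d → ∣ config v t d ∣ ≡ cost d + load v t
config-size v t zero = refl
config-size v t 1₄ = refl
config-size v t 2₄ = refl
config-size v t 3₄ = refl

subsetSum-flag-part : ∀ {m} (v : Vec (Fin 2) m) t →
  subsetSum ((replicate m (suc zero) , 3₄) ∷ unitVectors m) (t ∷ part t v) ≡ (v , offset v t)
subsetSum-flag-part v false
  rewrite subsetSum-unitVectors (toSubset v) | bits-toSubset v = refl
subsetSum-flag-part v true
  rewrite subsetSum-unitVectors (toSubset (flip v)) | bits-toSubset (flip v) | flip-involutive v = refl

config-sum : ∀ {m} (v : Vec (Fin 2) m) t d → subsetSum (basis m) (config v t d) ≡ (v , d +ₙ offset v t)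
config-sum {m} v t d = trans (subsetSum-digits d _ (t ∷ part t v))
  (cong (λ g → proj₁ g , d +ₙ proj₂ g) (subsetSum-flag-part v t))

config-surjective : ∀ {m} (S : Subset (3 + m)) → ∃₂ λ v t → ∃ λ d → config v t d ≡ S
config-surjective (x ∷ y ∷ t ∷ T) with digits-surjective x y
... | d , digits-d = flipIf t (bits T) , t , d ,
  cong₂ _++_ digits-d (cong (t ∷_) (trans (cong toSubset (flipIf-involutive t (bits T))) (toSubset-bits T)))

load-sum : ∀ {m} (v : Vec (Fin 2) m) → load v false + load v true ≡ suc m
load-sum v = trans (+-suc _ _) (cong suc (∣toSubset∣+∣toSubset∘flip∣≡n v))

offset-boundary : ∀ p (v : Vec (Fin 2) (p + p)) t → load v t ≡ p → offset v (not t) ≡ 3₄ +ₙ offset v t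
offset-boundary p v false w≡p = cong (λ n → 3₄ +ₙ toℤ₄ n) (+-cancelˡ-≡ p _ _ (begin
  p + ∣ part true v ∣                    ≡⟨ cong (_+ ∣ part true v ∣) (sym w≡p) ⟩
  ∣ part false v ∣ + ∣ part true v ∣     ≡⟨ ∣toSubset∣+∣toSubset∘flip∣≡n v ⟩
  p + p                                  ≡⟨ cong (p +_) w≡p ⟨
  p + ∣ part false v ∣                   ∎))
  where open ≡-Reasoning
offset-boundary p v true 1+w′≡p = begin
  toℤ₄ w                  ≡⟨ cong toℤ₄ w≡2+w′ ⟩
  1₄ +ₙ (1₄ +ₙ toℤ₄ w′)   ≡⟨ +₄-assoc 1₄ 1₄ (toℤ₄ w′) ⟩
  2₄ +ₙ toℤ₄ w′           ≡⟨ +₄-assoc 3₄ 3₄ (toℤ₄ w′) ⟨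
  3₄ +ₙ (3₄ +ₙ toℤ₄ w′)   ∎
  where
  open ≡-Reasoning
  w w′ : ℕ
  w = ∣ part false v ∣
  w′ = ∣ part true v ∣
  w≡2+w′ : w ≡ 2 + w′
  w≡2+w′ = +-cancelʳ-≡ w′ w (2 + w′)
    (begin
      w + w′                ≡⟨ ∣toSubset∣+∣toSubset∘flip∣≡n v ⟩
      p + p                 ≡⟨ cong₂ _+_ 1+w′≡p 1+w′≡p ⟨
      suc w′ + suc w′       ≡⟨ cong suc (+-suc w′ w′) ⟩
      2 + w′ + w′           ∎)

basis-perfect : ∀ p → PerfectRestrictedBasis (suc p) (basis (p + p))
basis-perfect p = covers , unique
  where
  module Branches (v : Vec (Fin 2) (p + p)) =
    TwoBranches p (load v) (offset v) (load-sum v) (offset-boundary p v)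

  covers : (g : G (p + p)) → ∃ λ S → ∣ S ∣ ≤ suc p × subsetSum (basis (p + p)) S ≡ g
  covers (v , c) with Branches.cover v c
  ... | t , d , fits , d+e≡c = config v t d , subst (_≤ suc p) (sym (config-size v t d)) fits ,
                               trans (config-sum v t d) (cong (v ,_) d+e≡c)

  config-injective : ∀ v v′ t t′ d d′ → ∣ config v t d ∣ ≤ suc p → ∣ config v′ t′ d′ ∣ ≤ suc p →
    subsetSum (basis (p + p)) (config v t d) ≡ subsetSum (basis (p + p)) (config v′ t′ d′) →
    config v t d ≡ config v′ t′ d′
  config-injective v v′ t t′ d d′ fits fits′ eq
    with sums ← trans (sym (config-sum v t d)) (trans eq (config-sum v′ t′ d′))
    with refl ← cong proj₁ sums
    with refl , refl ← Branches.unique v t t′ d d′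
           (subst (_≤ suc p) (config-size v t d) fits)
           (subst (_≤ suc p) (config-size v t′ d′) fits′) (cong proj₂ sums)
    = refl

  unique : (S S′ : Subset (3 + (p + p))) → ∣ S ∣ ≤ suc p → ∣ S′ ∣ ≤ suc p →
           subsetSum (basis (p + p)) S ≡ subsetSum (basis (p + p)) S′ → S ≡ S′
  unique S S′ with config-surjective S | config-surjective S′
  ... | v , t , d , refl | v′ , t′ , d′ , refl = config-injective v v′ t t′ d d′

2*[1+n]≡2+[n+n] : ∀ n → 2 * suc n ≡ 2 + (n + n)
2*[1+n]≡2+[n+n] n = trans (*-suc 2 n) (cong (λ k → 2 + (n + k)) (+-identityʳ n))

mainTheorem7 : (s : ℕ) → 1 ≤ s →
    ∃ λ (A : Vec (G (2 * s ∸ 2)) (2 * s + 1)) →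
      Injective _≡_ _≡_ (lookup A) × PerfectRestrictedBasis s A
mainTheorem7 (suc p) 1≤s =
  subst₂ (λ m k → ∃ λ (A : Vec (G m) k) → Injective _≡_ _≡_ (lookup A) × PerfectRestrictedBasis (suc p) A)
    (sym (cong (_∸ 2) (2*[1+n]≡2+[n+n] p)))
    (sym (trans (cong (_+ 1) (2*[1+n]≡2+[n+n] p)) (+-comm (2 + (p + p)) 1)))
    (basis (p + p) , perfect⇒injective (basis (p + p)) 1≤s (basis-perfect p) , basis-perfect p)
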